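{- Let $\lambda\vdash n$. For every $k=3,\dots,n$ and every $T\in SYT(\lambda)$, the filling $\Psi_k(T)$ is again a standard Young tableau of shape $\lambda$.
   Context: Cells of a Ferrers diagram are indexed by (row, column) coordinates $(i,j)$, rows numbered from the bottom and columns from the left; cell $(i,j)$ is the unit square $[j-1,j]\times[i-1,i]$ with lower left-hand corner $(j-1,i-1)$. $SYT(\lambda)$ is the set of fillings of the diagram of $\lambda$ by $1,\dots,n$ increasing left to right in rows and bottom to top in columns; $c(i,j)$ is the content of cell $(i,j)$. Path $\pi(T,k)$: start at the lower left-hand corner of the cell containing $k$. At the lower left-hand corner of a cell $(i,j)$: if $i=1$ or $j=1$ go straight to the origin and stop; otherwise step South one unit if $c(i-1,j)>c(i,j-1)$ and West one unit if $c(i-1,j)<c(i,j-1)$; iterate. If $k$ is in cell $(r,s)$, for each $1\le i\le r-1$ the path crosses the line $y=i-\tfrac12$ at a single abscissa $x_i$; a cell $(i,j)$ with content less than $k$ is below $\pi(T,k)$ if $i\le r-1$ and $j-\tfrac12>x_i$, and above otherwise. Map $\Psi_k$: partition the cells with content less than $k$ into blocks of maximal length of cells with consecutive contents $a,\dots,a+m$ such that the cell containing $a$ is on the same side of $\pi(T,k)$ as $(1,1)$ and the cells containing $a+1,\dots,a+m$ are on the other side. In each block replace the content $a$ by $a+m$ and each content $a+l$ ($1\le l\le m$) by $a+l-1$; other cells unchanged. The result is $\Psi_k(T)$. -}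

module Defs where

open import Data.Nat using (ℕ; zero; suc; _∸_; _≤_; _<_; _≥_; _<ᵇ_; _≡ᵇ_)
open import Data.Bool using (Bool; true; false; if_then_else_; _∧_; not; _xor_)
open import Data.List using (List; []; _∷_; length; map; concat; upTo)
open import Data.Nat.ListAction using (sum)
open import Data.List.Relation.Unary.All using (All)
open import Data.List.Relation.Unary.Linked using (Linked)
open import Data.Product using (_×_; _,_; proj₁; proj₂)
open import Relation.Binary.PropositionalEquality using (_≡_)

-- A shape is the list of row lengths, row 1 (bottom row) first.
Shape : Set
Shape = List ℕ

IsPartition : Shape → Set
IsPartition sh = Linked _≥_ sh × All (0 <_) sh

rowLen : Shape → ℕ → ℕ
rowLen []       _             = 0
rowLen (x ∷ xs) zero          = 0
rowLen (x ∷ xs) (suc zero)    = x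
rowLen (x ∷ xs) (suc (suc i)) = rowLen xs (suc i)

InShape : Shape → ℕ → ℕ → Set
InShape sh i j = 1 ≤ i × 1 ≤ j × j ≤ rowLen sh i

-- a filling assigns a number to each cell (i,j); values outside the diagram are irrelevant
Filling : Set
Filling = ℕ → ℕ → ℕ

record IsSYT (sh : Shape) (T : Filling) : Set where
  field
    rowInc : ∀ i j → InShape sh i j → InShape sh i (suc j) → T i j < T i (suc j)
    colInc : ∀ i j → InShape sh i j → InShape sh (suc i) j → T i j < T (suc i) j
    range  : ∀ i j → InShape sh i j → 1 ≤ T i j × T i j ≤ sum sh
    inj    : ∀ i j i' j' → InShape sh i j → InShape sh i' j' →
             T i j ≡ T i' j' → i ≡ i' × j ≡ j'

cells : Shape → List (ℕ × ℕ)
cells sh = concat (map (λ i → map (λ j → (suc i , suc j)) (upTo (rowLen sh (suc i))))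
                       (upTo (length sh)))

findCell : Filling → ℕ → List (ℕ × ℕ) → ℕ × ℕ
findCell T v []             = (1 , 1)
findCell T v ((i , j) ∷ cs) = if T i j ≡ᵇ v then (i , j) else findCell T v cs

-- pathX T i j l : the abscissa x_l at which the path started at the lower
-- left-hand corner of cell (i,j) crosses the line y = l - 1/2 (for 1 ≤ l ≤ i-1).
-- At cell (i,j) with i,j ≥ 2: South if T(i-1,j) > T(i,j-1) (crossing level i-1
-- at abscissa j-1), West otherwise (the case of equality never occurs for a SYT).
-- If i = 1 or j = 1 the path goes straight to the origin (abscissa 0).
pathX : Filling → ℕ → ℕ → ℕ → ℕ
pathX T (suc (suc a)) (suc (suc b)) l =
  if T (suc (suc a)) (suc b) <ᵇ T (suc a) (suc (suc b))
  then (if l ≡ᵇ suc a then suc b else pathX T (suc a) (suc (suc b)) l)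
  else pathX T (suc (suc a)) (suc b) l
pathX T _ _ l = 0

-- cell (i,j) is below the path π(T,(r,s)) iff i ≤ r-1 and j - 1/2 > x_i (i.e. x_i < j)
belowᵇ : Filling → ℕ → ℕ → ℕ → ℕ → Bool
belowᵇ T r s i j = (i <ᵇ r) ∧ (pathX T r s i <ᵇ j)

sameᵇ : Bool → Bool → Bool
sameᵇ a b = not (a xor b)

module _ (sh : Shape) (T : Filling) (k : ℕ) where

  posK : ℕ × ℕ
  posK = findCell T k (cells sh)

  side : ℕ → ℕ → Bool
  side i j = belowᵇ T (proj₁ posK) (proj₂ posK) i j

  side₀ : Bool
  side₀ = side 1 1

  sideVal : ℕ → Bool
  sideVal v = side (proj₁ (findCell T v (cells sh))) (proj₂ (findCell T v (cells sh)))

  runEnd : ℕ → ℕ → ℕ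
  runEnd zero    w = w
  runEnd (suc f) w = if sameᵇ (sideVal (suc w)) side₀ then w else runEnd f (suc w)

  -- Ψ_k(T): in a maximal block a,…,a+m (a on the side of (1,1), a+1,…,a+m on the
  -- other side, all < k) replace a by a+m and a+l by a+l-1; other cells unchanged.
  Ψ : Filling
  Ψ i j = if T i j <ᵇ k
          then (if sameᵇ (side i j) side₀ then runEnd (k ∸ suc (T i j)) (T i j) else T i j ∸ 1)
          else T i j

-- Ψ_k acts on contents through a map φ of values, fixing every value ≥ k: the
-- first value a of a block a, …, a+m goes to a+m and the others go down by one.
-- φ is injective, and for v < w it reverses the order only when w lies in the
-- block of v: the cell of v is on the side of (1,1), the cell of w is not, and
-- no value strictly between them has its cell on the side of (1,1).
-- Neighbouring cells on opposite sides of π(T,k) always have such an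
-- intermediate value. Where the path passes between (i,j) and (i,j+1) it steps
-- South from the corner of (i+1,j+1), so T(i+1,j) < T(i,j+1), and (i+1,j) lies
-- on the side of (i,j). Where it passes between (i,j) and (i+1,j) with
-- T(i+1,j) < k it steps West from that corner, so T(i,j+1) < T(i+1,j), and
-- (i,j+1) lies on the side of (i,j). Hence φ keeps rows and columns increasing.

{-# OPTIONS --safe --termination-depth=2 #-}
module Submission where

open import Defs
open import Data.Nat using (ℕ; zero; suc; 2+; _+_; _∸_; _≤_; _<_; _≥_; _<ᵇ_; _≡ᵇ_; z≤n; s≤s; s≤s⁻¹; z<s)
open import Data.Nat.Properties
open import Data.Nat.ListAction using (sum)
open import Data.Bool using (Bool; true; false; if_then_else_)
open import Data.Bool.Properties using (not-¬)
open import Data.List using (List; []; _∷_; length; map; upTo)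
open import Data.List.Relation.Unary.Linked using (Linked; _∷_)
open import Data.List.Relation.Unary.Any using (here; there)
open import Data.List.Membership.Propositional using (_∈_)
open import Data.List.Membership.Propositional.Properties using (∈-map⁺; ∈-map⁻; ∈-concat⁺′; ∈-concat⁻′; ∈-upTo⁺; ∈-upTo⁻)
open import Data.Product using (_×_; _,_; proj₁; proj₂; ∃-syntax; ∃₂; uncurry)
import Data.Product as Product
open import Data.Sum using (_⊎_; inj₁; inj₂; map₁; map₂)
open import Data.Empty using (⊥-elim)
open import Function using (_∘_)
open import Relation.Binary.PropositionalEquality using (_≡_; _≢_; refl; sym; trans; cong; cong₂; subst; subst₂)
open import Relation.Binary.Definitions using (tri<; tri≈; tri>)
open import Relation.Nullary using (contradiction; yes; no)
open import Relation.Nullary.Reflects using (Reflects; ofʸ; ofⁿ; fromEquivalence; det; _×-reflects_)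

≡ᵇ-reflects-≡ : ∀ m n → Reflects (m ≡ n) (m ≡ᵇ n)
≡ᵇ-reflects-≡ m n = fromEquivalence (≡ᵇ⇒≡ m n) (≡⇒≡ᵇ m n)

≡⇒sameᵇ : ∀ {a b} → a ≡ b → sameᵇ a b ≡ true
≡⇒sameᵇ {false} refl = refl
≡⇒sameᵇ {true}  refl = refl

sameᵇ⇒≡ : ∀ {a b} → sameᵇ a b ≡ true → a ≡ b
sameᵇ⇒≡ {false} {false} _ = refl
sameᵇ⇒≡ {true}  {true}  _ = refl

sameᵇ⇒≢ : ∀ {a b} → sameᵇ a b ≡ false → a ≢ b
sameᵇ⇒≢ {false} {true}  _ ()
sameᵇ⇒≢ {true}  {false} _ ()

-- shift is the map φ for an arbitrary colouring; for Ψ_k, start v says that the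
-- cell of v lies on the side of (1,1), i.e. that v can only begin a block.
module BlockShift (k : ℕ) (start : ℕ → Bool) where

  blockEnd : ℕ → ℕ → ℕ
  blockEnd zero    w = w
  blockEnd (suc f) w = if start (suc w) then w else blockEnd f (suc w)

  blockEnd-≥ : ∀ f w → w ≤ blockEnd f w
  blockEnd-≥ zero    w = ≤-refl
  blockEnd-≥ (suc f) w with start (suc w)
  ... | true  = ≤-refl
  ... | false = <⇒≤ (blockEnd-≥ f (suc w))

  blockEnd-≤ : ∀ f w → blockEnd f w ≤ w + f
  blockEnd-≤ zero    w = m≤m+n w 0
  blockEnd-≤ (suc f) w with start (suc w)
  ... | true  = m≤m+n w (suc f)
  ... | false = ≤-trans (blockEnd-≤ f (suc w)) (≤-reflexive (sym (+-suc w f)))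

  blockEnd-interior : ∀ f {w u} → w < u → u ≤ blockEnd f w → start u ≡ false
  blockEnd-interior zero    w<u u≤w = contradiction u≤w (<⇒≱ w<u)
  blockEnd-interior (suc f) {w} w<u u≤end with start (suc w) in eq
  ... | true  = contradiction u≤end (<⇒≱ w<u)
  ... | false with m≤n⇒m<n∨m≡n w<u
  ...   | inj₁ sw<u = blockEnd-interior f sw<u u≤end
  ...   | inj₂ refl = eq

  blockEnd-maximal : ∀ f w → blockEnd f w ≡ w + f ⊎ start (suc (blockEnd f w)) ≡ true
  blockEnd-maximal zero    w = inj₁ (sym (+-identityʳ w))
  blockEnd-maximal (suc f) w with start (suc w) in eq
  ... | true  = inj₂ eq
  ... | false = map₁ (λ e → trans e (sym (+-suc w f))) (blockEnd-maximal f (suc w))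

  lastOfBlock : ℕ → ℕ
  lastOfBlock v = blockEnd (k ∸ suc v) v

  lastOfBlock-≥ : ∀ v → v ≤ lastOfBlock v
  lastOfBlock-≥ v = blockEnd-≥ (k ∸ suc v) v

  lastOfBlock-< : ∀ {v} → v < k → lastOfBlock v < k
  lastOfBlock-< {v} v<k = ≤-trans (s≤s (blockEnd-≤ (k ∸ suc v) v)) (≤-reflexive (m+[n∸m]≡n v<k))

  lastOfBlock-<-start : ∀ {v w} → v < w → start w ≡ true → lastOfBlock v < w
  lastOfBlock-<-start {v} v<w w-starts =
    ≰⇒> λ w≤last → contradiction (blockEnd-interior (k ∸ suc v) v<w w≤last) (not-¬ w-starts)

  start-after-lastOfBlock : ∀ {v w} → v < k → w < k → suc (lastOfBlock v) ≡ w → start w ≡ true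
  start-after-lastOfBlock {v} v<k w<k refl with blockEnd-maximal (k ∸ suc v) v
  ... | inj₂ starts = starts
  ... | inj₁ full   = contradiction (trans (cong suc full) (m+[n∸m]≡n v<k)) (<⇒≢ w<k)

  shift : ℕ → ℕ
  shift v = if v <ᵇ k then (if start v then lastOfBlock v else v ∸ 1) else v

  data ShiftView (v : ℕ) : ℕ → Set where
    fixed    : k ≤ v → ShiftView v v
    toLast   : v < k → start v ≡ true  → ShiftView v (lastOfBlock v)
    backward : v < k → start v ≡ false → ShiftView v (v ∸ 1)

  shiftView : ∀ v → ShiftView v (shift v)
  shiftView v with v <ᵇ k | <ᵇ-reflects-< v k
  ... | false | ofⁿ v≮k = fixed (≮⇒≥ v≮k)
  ... | true  | ofʸ v<k with start v in eq
  ...   | true  = toLast v<k eq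
  ...   | false = backward v<k eq

  OutsideBlock : ℕ → ℕ → Set
  OutsideBlock v w = w < k → start v ≡ true → start w ≡ false → ∃[ u ] v < u × u < w × start u ≡ true

  shift-mono : ∀ {v w} → 1 ≤ v → v < w → OutsideBlock v w → shift v < shift w
  shift-mono {v} {w} 1≤v v<w outside with shift v | shiftView v | shift w | shiftView w
  ... | _ | fixed _       | _ | fixed _         = v<w
  ... | _ | toLast v<k _  | _ | fixed k≤w       = <-≤-trans (lastOfBlock-< v<k) k≤w
  ... | _ | backward _ _  | _ | fixed _         = ≤-<-trans pred[n]≤n v<w
  ... | _ | fixed k≤v     | _ | toLast w<k _    = contradiction (<-trans v<w w<k) (≤⇒≯ k≤v)
  ... | _ | fixed k≤v     | _ | backward w<k _  = contradiction (<-trans v<w w<k) (≤⇒≯ k≤v)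
  ... | _ | toLast _ _    | _ | toLast _ w-st   = <-≤-trans (lastOfBlock-<-start v<w w-st) (lastOfBlock-≥ w)
  ... | _ | backward _ _  | _ | toLast _ _      = ≤-<-trans pred[n]≤n (<-≤-trans v<w (lastOfBlock-≥ w))
  ... | _ | backward _ _  | _ | backward _ _    = ∸-monoˡ-< v<w 1≤v
  ... | _ | toLast _ v-st | _ | backward w<k w-nst with outside w<k v-st w-nst
  ...   | u , v<u , u<w , u-st = <-≤-trans (lastOfBlock-<-start v<u u-st) (<⇒≤pred u<w)

  shift-injective : ∀ {v w} → 1 ≤ v → 1 ≤ w → shift v ≡ shift w → v ≡ w
  shift-injective {v@(suc v′)} {w@(suc w′)} _ _ eq with shift v | shiftView v | shift w | shiftView w
  ... | _ | fixed _            | _ | fixed _            = eq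
  ... | _ | backward _ _       | _ | backward _ _       = cong suc eq
  ... | _ | fixed k≤v          | _ | toLast w<k _       =
    contradiction eq (>⇒≢ (<-≤-trans (lastOfBlock-< w<k) k≤v))
  ... | _ | fixed k≤v          | _ | backward w<k _     =
    contradiction eq (>⇒≢ (<-≤-trans (<-trans (n<1+n w′) w<k) k≤v))
  ... | _ | toLast v<k _       | _ | fixed k≤w          =
    contradiction eq (<⇒≢ (<-≤-trans (lastOfBlock-< v<k) k≤w))
  ... | _ | backward v<k _     | _ | fixed k≤w          =
    contradiction eq (<⇒≢ (<-≤-trans (<-trans (n<1+n v′) v<k) k≤w))
  ... | _ | toLast v<k _       | _ | backward w<k w-nst =
    contradiction w-nst (not-¬ (start-after-lastOfBlock v<k w<k (cong suc eq)))
  ... | _ | backward v<k v-nst | _ | toLast w<k _       =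
    contradiction v-nst (not-¬ (start-after-lastOfBlock w<k v<k (cong suc (sym eq))))
  ... | _ | toLast _ v-st      | _ | toLast _ w-st with <-cmp v w
  ...   | tri< v<w _ _ = contradiction eq (<⇒≢ (<-≤-trans (lastOfBlock-<-start v<w w-st) (lastOfBlock-≥ w)))
  ...   | tri≈ _ v≡w _ = v≡w
  ...   | tri> _ _ w<v = contradiction eq (>⇒≢ (<-≤-trans (lastOfBlock-<-start w<v v-st) (lastOfBlock-≥ v)))

  shift-≤ : ∀ {v N} → v ≤ N → k ≤ N → shift v ≤ N
  shift-≤ {v} v≤N k≤N with shift v | shiftView v
  ... | _ | fixed _      = v≤N
  ... | _ | toLast v<k _ = <⇒≤ (<-≤-trans (lastOfBlock-< v<k) k≤N)
  ... | _ | backward _ _ = ≤-trans pred[n]≤n v≤N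

  shift-positive : ∀ {v} → 1 ≤ v → (start v ≡ false → 2 ≤ v) → 1 ≤ shift v
  shift-positive {v} 1≤v 2≤v with shift v | shiftView v
  ... | _ | fixed _          = 1≤v
  ... | _ | toLast _ _       = ≤-trans 1≤v (lastOfBlock-≥ v)
  ... | _ | backward _ v-nst = ∸-monoˡ-≤ 1 (2≤v v-nst)

rowLen-antitone : ∀ {sh} → Linked _≥_ sh → ∀ i → rowLen sh (2+ i) ≤ rowLen sh (suc i)
rowLen-antitone {[]}         _          _       = z≤n
rowLen-antitone {x ∷ []}     _          zero    = z≤n
rowLen-antitone {x ∷ []}     _          (suc i) = z≤n
rowLen-antitone {x ∷ y ∷ ys} (x≥y ∷ _)  zero    = x≥y
rowLen-antitone {x ∷ y ∷ ys} (_ ∷ y≥ys) (suc i) = rowLen-antitone y≥ys i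

rowLen>0⇒<length : ∀ sh i → 0 < rowLen sh (suc i) → i < length sh
rowLen>0⇒<length (x ∷ xs) zero    _   = z<s
rowLen>0⇒<length (x ∷ xs) (suc i) len = s≤s (rowLen>0⇒<length xs i len)

cellsOfRow : Shape → ℕ → List (ℕ × ℕ)
cellsOfRow sh i = map (λ j → (suc i , suc j)) (upTo (rowLen sh (suc i)))

∈-cells⁻ : ∀ sh {c} → c ∈ cells sh → InShape sh (proj₁ c) (proj₂ c)
∈-cells⁻ sh c∈ with ∈-concat⁻′ (map (cellsOfRow sh) (upTo (length sh))) c∈
... | row , c∈row , row∈ with ∈-map⁻ (cellsOfRow sh) row∈
... | i , _ , refl with ∈-map⁻ (λ j → (suc i , suc j)) c∈row
... | j , j∈ , refl = z<s , z<s , ∈-upTo⁻ j∈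

∈-cells⁺ : ∀ sh {i j} → InShape sh i j → (i , j) ∈ cells sh
∈-cells⁺ sh {suc i} {suc j} (_ , _ , j<len) =
  ∈-concat⁺′ (∈-map⁺ (λ j → (suc i , suc j)) (∈-upTo⁺ j<len))
             (∈-map⁺ (cellsOfRow sh) (∈-upTo⁺ (rowLen>0⇒<length sh i (≤-<-trans z≤n j<len))))

module _ (T : Filling) (v : ℕ) where

  HoldsIn : List (ℕ × ℕ) → ℕ × ℕ → Set
  HoldsIn cs c = c ∈ cs × uncurry T c ≡ v

  findCell-sound : ∀ cs → findCell T v cs ≡ (1 , 1) ⊎ HoldsIn cs (findCell T v cs)
  findCell-sound []             = inj₁ refl
  findCell-sound ((i , j) ∷ cs) with T i j ≡ᵇ v | ≡ᵇ-reflects-≡ (T i j) v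
  ... | true  | ofʸ found = inj₂ (here refl , found)
  ... | false | _         = map₂ (Product.map₁ there) (findCell-sound cs)

  findCell-complete : ∀ {cs i j} → (i , j) ∈ cs → T i j ≡ v → HoldsIn cs (findCell T v cs)
  findCell-complete {(i , j) ∷ cs} _ _ with T i j ≡ᵇ v | ≡ᵇ-reflects-≡ (T i j) v
  ... | true  | ofʸ found = here refl , found
  findCell-complete (here refl) Tij≡v | false | ofⁿ ¬found = contradiction Tij≡v ¬found
  findCell-complete (there ij∈) Tij≡v | false | _         =
    Product.map₁ there (findCell-complete ij∈ Tij≡v)

module Tableau {sh : Shape} (ordered : Linked _≥_ sh) {T : Filling} (syt : IsSYT sh T) where

  open IsSYT syt

  inShape-down : ∀ {i j} → 1 ≤ i → InShape sh (suc i) j → InShape sh i j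
  inShape-down z<s (_ , 1≤j , j≤len) = z<s , 1≤j , ≤-trans j≤len (rowLen-antitone ordered _)

  inShape-left : ∀ {i j} → 1 ≤ j → InShape sh i (suc j) → InShape sh i j
  inShape-left 1≤j (1≤i , _ , 1+j≤len) = 1≤i , 1≤j , <⇒≤ 1+j≤len

  findCell-cell : ∀ {i j} → InShape sh i j → findCell T (T i j) (cells sh) ≡ (i , j)
  findCell-cell {i} {j} ij =
    let c = findCell T (T i j) (cells sh)
        c∈ , Tc≡Tij = findCell-complete T (T i j) (∈-cells⁺ sh ij) refl
    in uncurry (cong₂ _,_) (inj (proj₁ c) (proj₂ c) i j (∈-cells⁻ sh c∈) ij Tc≡Tij)

  row-monotone : ∀ {i j} j′ → 1 ≤ j → j ≤ j′ → InShape sh i j′ → T i j ≤ T i j′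
  row-monotone zero     z<s ()
  row-monotone (suc j′) 1≤j j≤1+j′ ij′ with m≤n⇒m<n∨m≡n j≤1+j′
  ... | inj₂ refl       = ≤-refl
  ... | inj₁ (s≤s j≤j′) =
    let left = inShape-left (≤-trans 1≤j j≤j′) ij′
    in ≤-trans (row-monotone j′ 1≤j j≤j′ left) (<⇒≤ (rowInc _ _ left ij′))

  row-reflects-< : ∀ {i j i′ j′} → InShape sh i j → InShape sh i′ j′ → i ≡ i′ →
                   T i j < T i′ j′ → j < j′
  row-reflects-< ij ij′ refl Tij<Tij′ =
    ≰⇒> λ j′≤j → <⇒≱ Tij<Tij′ (row-monotone _ (proj₁ (proj₂ ij′)) j′≤j ij)

  T-≥2-off-origin : ∀ {i j} → InShape sh i j → (i , j) ≢ (1 , 1) → 2 ≤ T i j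
  T-≥2-off-origin {suc i} {2+ j} ij _ =
    let left = inShape-left z<s ij in ≤-<-trans (proj₁ (range _ _ left)) (rowInc _ _ left ij)
  T-≥2-off-origin {2+ i} {suc zero} ij _ =
    let down = inShape-down z<s ij in ≤-<-trans (proj₁ (range _ _ down)) (colInc _ _ down ij)
  T-≥2-off-origin {suc zero} {suc zero} _ off = contradiction refl off

  pathX-≤ : ∀ a b l → pathX T a (suc b) l ≤ b
  pathX-≤ (2+ a) (suc b) l with T (2+ a) (suc b) <ᵇ T (suc a) (2+ b) | l ≡ᵇ suc a
  ... | false | _     = m≤n⇒m≤1+n (pathX-≤ (2+ a) b l)
  ... | true  | true  = ≤-refl
  ... | true  | false = pathX-≤ (suc a) (suc b) l
  pathX-≤ zero       _    _ = z≤n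
  pathX-≤ (suc zero) _    _ = z≤n
  pathX-≤ (2+ a)     zero _ = z≤n

  pathX-mono : ∀ a b l → suc l < a → pathX T a b l ≤ pathX T a b (suc l)
  pathX-mono (2+ a) (2+ b) l (s≤s l<1+a) with T (2+ a) (suc b) <ᵇ T (suc a) (2+ b)
  ... | false = pathX-mono (2+ a) (suc b) l (s≤s l<1+a)
  ... | true with l ≡ᵇ suc a | ≡ᵇ-reflects-≡ l (suc a) | l ≡ᵇ a | ≡ᵇ-reflects-≡ l a
  ...   | true  | ofʸ refl | _     | _        = contradiction l<1+a (n≮n _)
  ...   | false | _        | true  | ofʸ refl = pathX-≤ (suc a) (suc b) a
  ...   | false | _        | false | ofⁿ l≢a  =
    pathX-mono (suc a) (2+ b) l (≤∧≢⇒< l<1+a (l≢a ∘ suc-injective))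
  pathX-mono zero       _          _ _ = z≤n
  pathX-mono (suc zero) _          _ _ = z≤n
  pathX-mono (2+ a)     zero       _ _ = z≤n
  pathX-mono (2+ a)     (suc zero) _ _ = z≤n

  southStep : ∀ {a b i j} → InShape sh a b → pathX T a b i ≡ j → 1 ≤ j →
              InShape sh (suc i) (suc j) × T (suc i) j < T i (suc j)
  southStep {2+ a} {2+ b} {i} ab x≡j 1≤j
    with T (2+ a) (suc b) <ᵇ T (suc a) (2+ b) | <ᵇ-reflects-< (T (2+ a) (suc b)) (T (suc a) (2+ b))
  ... | false | _ = southStep (inShape-left z<s ab) x≡j 1≤j
  ... | true  | ofʸ _ with i ≡ᵇ suc a | ≡ᵇ-reflects-≡ i (suc a)
  ...   | false | _ = southStep (inShape-down z<s ab) x≡j 1≤j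
  southStep ab refl _ | true | ofʸ south | true | ofʸ refl = ab , south
  southStep {zero}            _ refl ()
  southStep {suc zero}        _ refl ()
  southStep {2+ a} {zero}     _ refl ()
  southStep {2+ a} {suc zero} _ refl ()

  -- The last three hypotheses say that the path runs along the line y = i across
  -- abscissa j: it leaves that line at x_i < j and enters it at x_(i+1) ≥ j, or at
  -- b - 1 ≥ j when i + 1 = a.
  westStep : ∀ {a b i j} → InShape sh a b → 1 ≤ i → i < a → pathX T a b i < j →
             (suc i ≡ a → j < b) → (suc i < a → j ≤ pathX T a b (suc i)) →
             InShape sh (suc i) (suc j) × T i (suc j) < T (suc i) j
  westStep {2+ a} {2+ b} {i} {j} ab 1≤i i<a x<j atTop belowTop
    with T (2+ a) (suc b) <ᵇ T (suc a) (2+ b) | <ᵇ-reflects-< (T (2+ a) (suc b)) (T (suc a) (2+ b))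
  ... | true | ofʸ _ with i ≡ᵇ suc a | ≡ᵇ-reflects-≡ i (suc a) | i ≡ᵇ a | ≡ᵇ-reflects-≡ i a
  ...   | true  | ofʸ refl | _     | _        = contradiction (atTop refl) (≤⇒≯ x<j)
  ...   | false | _        | true  | ofʸ refl =
    westStep (inShape-down z<s ab) 1≤i ≤-refl x<j (λ _ → s≤s (belowTop ≤-refl)) (⊥-elim ∘ n≮n _)
  ...   | false | ofⁿ i≢   | false | ofⁿ i≢′  =
    westStep (inShape-down z<s ab) 1≤i (≤∧≢⇒< (s≤s⁻¹ i<a) i≢) x<j
             (⊥-elim ∘ i≢′ ∘ suc-injective) (belowTop ∘ m<n⇒m<1+n)
  westStep {2+ a} {2+ b} {i} {j} ab 1≤i i<a x<j atTop belowTop | false | ofⁿ ¬south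
    with i ≟ suc a | j ≟ suc b
  ... | yes refl | yes refl =
    let down = inShape-down z<s ab
        left = inShape-left z<s ab
    in ab , ≤∧≢⇒< (≮⇒≥ ¬south) (1+n≢n ∘ sym ∘ proj₁ ∘ inj _ _ _ _ down left)
  ... | yes refl | no j≢    =
    westStep (inShape-left z<s ab) 1≤i i<a x<j (λ _ → ≤∧≢⇒< (s≤s⁻¹ (atTop refl)) j≢) belowTop
  ... | no i≢    | _        =
    westStep (inShape-left z<s ab) 1≤i i<a x<j (⊥-elim ∘ i≢ ∘ suc-injective) belowTop
  westStep {zero}     _ _   ()
  westStep {suc zero} _ z<s (s≤s ())
  westStep {2+ a} {zero} _ _ i<a x<j atTop belowTop with m≤n⇒m<n∨m≡n i<a
  ... | inj₁ 1+i<a = contradiction x<j (≤⇒≯ (belowTop 1+i<a))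
  ... | inj₂ 1+i≡a = contradiction (atTop 1+i≡a) λ ()
  westStep {2+ a} {suc zero} _ _ i<a x<j atTop belowTop with m≤n⇒m<n∨m≡n i<a
  ... | inj₁ 1+i<a = contradiction x<j (≤⇒≯ (belowTop 1+i<a))
  ... | inj₂ 1+i≡a = contradiction x<j (≤⇒≯ (s≤s⁻¹ (atTop 1+i≡a)))

  module AtPosition (k : ℕ) where

    r s : ℕ
    r = proj₁ (posK sh T k)
    s = proj₂ (posK sh T k)

    -- posK falls back to (1,1) when no cell holds k.
    cellOfK : 1 < r → InShape sh r s × T r s ≡ k
    cellOfK 1<r with findCell-sound T k (cells sh)
    ... | inj₁ default        = contradiction (cong proj₁ default) (>⇒≢ 1<r)
    ... | inj₂ (rs∈ , Trs≡k) = ∈-cells⁻ sh rs∈ , Trs≡k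

    Below : ℕ → ℕ → Set
    Below i j = i < r × pathX T r s i < j

    side-reflects-Below : ∀ i j → Reflects (Below i j) (side sh T k i j)
    side-reflects-Below i j = <ᵇ-reflects-< i r ×-reflects <ᵇ-reflects-< (pathX T r s i) j

    Below-right : ∀ {i j} → Below i j → Below i (suc j)
    Below-right (i<r , x<j) = i<r , m<n⇒m<1+n x<j

    Below-down : ∀ {i j} → Below (suc i) j → Below i j
    Below-down (1+i<r , x<j) = <-trans (n<1+n _) 1+i<r , ≤-<-trans (pathX-mono r s _ 1+i<r) x<j

    SameSideBetween : ℕ → ℕ → ℕ → ℕ → Set
    SameSideBetween i j i′ j′ =
      ∃₂ λ i″ j″ → InShape sh i″ j″ × T i j < T i″ j″ × T i″ j″ < T i′ j′ ×
                 side sh T k i″ j″ ≡ side sh T k i j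

    rowCrossing : ∀ {i j} → InShape sh i j → InShape sh i (suc j) →
                  side sh T k i j ≢ side sh T k i (suc j) → SameSideBetween i j i (suc j)
    rowCrossing {i} {j} ij ij′ sides
      with side sh T k i j     | side-reflects-Below i j
         | side sh T k i (suc j) | side-reflects-Below i (suc j)
    ... | true  | ofʸ below  | false | ofⁿ ¬below′       = contradiction (Below-right below) ¬below′
    ... | false | ofⁿ ¬below | true  | ofʸ (i<r , x<1+j) =
      let x≡j           = ≤-antisym (s≤s⁻¹ x<1+j) (≮⇒≥ (¬below ∘ (i<r ,_)))
          corner , south = southStep (proj₁ (cellOfK (≤-<-trans (proj₁ ij) i<r))) x≡j (proj₁ (proj₂ ij))
          up            = inShape-left (proj₁ (proj₂ ij)) corner
      in suc i , j , up , colInc i j ij up , south ,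
         det (side-reflects-Below (suc i) j) (ofⁿ (¬below ∘ Below-down))
    ... | true  | _ | true  | _ = contradiction refl sides
    ... | false | _ | false | _ = contradiction refl sides

    colCrossing : ∀ {i j} → InShape sh i j → InShape sh (suc i) j → T (suc i) j < k →
                  side sh T k i j ≢ side sh T k (suc i) j → SameSideBetween i j (suc i) j
    colCrossing {i} {j} ij ij′ T<k sides
      with side sh T k i j     | side-reflects-Below i j
         | side sh T k (suc i) j | side-reflects-Below (suc i) j
    ... | false | ofⁿ ¬below      | true  | ofʸ below′ = contradiction (Below-down below′) ¬below
    ... | true  | ofʸ (i<r , x<j) | false | ofⁿ ¬below′ =
      let rs , Trs≡k    = cellOfK (≤-<-trans (proj₁ ij) i<r)
          atTop         = λ 1+i≡r → row-reflects-< ij′ rs 1+i≡r (subst (T (suc i) j <_) (sym Trs≡k) T<k)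
          belowTop      = λ 1+i<r → ≮⇒≥ (¬below′ ∘ (1+i<r ,_))
          corner , west = westStep rs (proj₁ ij) i<r x<j atTop belowTop
          right         = inShape-down (proj₁ ij) corner
      in i , suc j , right , rowInc i j ij right , west ,
         det (side-reflects-Below i (suc j)) (ofʸ (Below-right (i<r , x<j)))
    ... | true  | _ | true  | _ = contradiction refl sides
    ... | false | _ | false | _ = contradiction refl sides

    startsBlock : ℕ → Bool
    startsBlock v = sameᵇ (sideVal sh T k v) (side₀ sh T k)

    open BlockShift k startsBlock

    runEnd≡blockEnd : ∀ f w → runEnd sh T k f w ≡ blockEnd f w
    runEnd≡blockEnd zero    w = refl
    runEnd≡blockEnd (suc f) w = cong (if startsBlock (suc w) then w else_) (runEnd≡blockEnd f (suc w))

    startsBlock-cell : ∀ {i j} → InShape sh i j →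
                       startsBlock (T i j) ≡ sameᵇ (side sh T k i j) (side₀ sh T k)
    startsBlock-cell ij = cong (λ c → sameᵇ (uncurry (side sh T k) c) (side₀ sh T k)) (findCell-cell ij)

    origin-startsBlock : InShape sh 1 1 → startsBlock (T 1 1) ≡ true
    origin-startsBlock o = trans (startsBlock-cell o) (≡⇒sameᵇ {side sh T k 1 1} refl)

    Ψ-cell : ∀ {i j} → InShape sh i j → Ψ sh T k i j ≡ shift (T i j)
    Ψ-cell {i} {j} ij = cong₂ (λ b e → if T i j <ᵇ k then (if b then e else T i j ∸ 1) else T i j)
                              (sym (startsBlock-cell ij)) (runEnd≡blockEnd (k ∸ suc (T i j)) (T i j))

    crossing⇒outsideBlock : ∀ {i j i′ j′} → InShape sh i j → InShape sh i′ j′ →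
      (T i′ j′ < k → side sh T k i j ≢ side sh T k i′ j′ → SameSideBetween i j i′ j′) →
      OutsideBlock (T i j) (T i′ j′)
    crossing⇒outsideBlock ij ij′ crossing T′<k starts ¬starts′ =
      let side≡side₀  = sameᵇ⇒≡ (trans (sym (startsBlock-cell ij)) starts)
          side′≢side₀ = sameᵇ⇒≢ (trans (sym (startsBlock-cell ij′)) ¬starts′)
          i″ , j″ , c , lt , gt , same =
            crossing T′<k (λ eq → side′≢side₀ (trans (sym eq) side≡side₀))
      in T i″ j″ , lt , gt , trans (startsBlock-cell c) (≡⇒sameᵇ (trans same side≡side₀))

    Ψ-isSYT : k ≤ sum sh → IsSYT sh (Ψ sh T k)
    Ψ-isSYT k≤n = record
      { rowInc = λ i j ij ij′ → subst₂ _<_ (sym (Ψ-cell ij)) (sym (Ψ-cell ij′))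
                   (shift-mono (positive ij) (rowInc i j ij ij′)
                               (crossing⇒outsideBlock ij ij′ λ _ → rowCrossing ij ij′))
      ; colInc = λ i j ij ij′ → subst₂ _<_ (sym (Ψ-cell ij)) (sym (Ψ-cell ij′))
                   (shift-mono (positive ij) (colInc i j ij ij′)
                               (crossing⇒outsideBlock ij ij′ (colCrossing ij ij′)))
      ; range  = λ i j ij → subst (λ v → 1 ≤ v × v ≤ sum sh) (sym (Ψ-cell ij))
                   (shift-positive (positive ij) (¬starts⇒≥2 ij) , shift-≤ (proj₂ (range i j ij)) k≤n)
      ; inj    = λ i j i′ j′ ij ij′ eq → inj i j i′ j′ ij ij′
                   (shift-injective (positive ij) (positive ij′)
                                    (trans (sym (Ψ-cell ij)) (trans eq (Ψ-cell ij′))))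
      }
      where
      positive : ∀ {i j} → InShape sh i j → 1 ≤ T i j
      positive ij = proj₁ (range _ _ ij)

      ¬starts⇒≥2 : ∀ {i j} → InShape sh i j → startsBlock (T i j) ≡ false → 2 ≤ T i j
      ¬starts⇒≥2 ij ¬starts =
        T-≥2-off-origin ij λ { refl → contradiction ¬starts (not-¬ (origin-startsBlock ij)) }

theorem4 : (sh : Shape) (n : ℕ) → IsPartition sh → sum sh ≡ n →
    (k : ℕ) → 3 ≤ k → k ≤ n → (T : Filling) → IsSYT sh T → IsSYT sh (Ψ sh T k)
theorem4 sh _ (ordered , _) refl k _ k≤n T syt = Ψ-isSYT k≤n
  where open Tableau ordered syt
        open AtPosition k
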